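{- Let $\Sigma$ be an alphabet with converse and $S$ a CFCST system over $\Sigma$. Every derivation in the calculus $\mathsf{Km}(S)\mathsf{L}$ of a labelled sequent of the form $\Rightarrow w:\phi$ is a labelled tree derivation with the fixed root property: every labelled sequent occurring in it has a sequent graph that is a tree with root $w$.
   Context: Alphabet with converse: finite $\Sigma$ with involution $\chi\mapsto\overline{\chi}$; $\overline{\chi_1\cdots\chi_n}=\overline{\chi_n}\cdots\overline{\chi_1}$, $\overline{\varepsilon}=\varepsilon$. A CFCST system $S$ is a set of rules $\chi\to s$ ($\chi\in\Sigma$, $s\in\Sigma^*$) closed under $\chi\to s\in S\Rightarrow\overline{\chi}\to\overline{s}\in S$; $L_S(\chi)$ is the set of strings derivable from $\chi$ by repeatedly rewriting a character $\chi'$ into $s'$ for $\chi'\to s'\in S$ (zero or more steps). Formulas: $\phi::=p\mid\overline{p}\mid\phi\vee\phi\mid\phi\wedge\phi\mid\langle\chi\rangle\phi\mid[\chi]\phi$. Labelled sequents $\mathcal{R}\Rightarrow\Gamma$: $\mathcal{R}$ a multiset of relational atoms $R_\chi wu$, $\Gamma$ a multiset of labelled formulas $w:\phi$. Sequent graph of a labelled sequent: vertices are the labels occurring in it, with a directed edge $w\to u$ (labelled $\chi$) for each $R_\chi wu\in\mathcal{R}$; it is a tree with root $w$ if there is a unique directed path from $w$ to every vertex. Propagation graph: same vertices, edges $(w,u,\chi)$ and $(u,w,\overline{\chi})$ for each $R_\chi wu$; propagation paths and their strings as usual (a length-$0$ path has string $\varepsilon$). $\mathsf{Km}(S)\mathsf{L}$: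 $(id)$: $\mathcal{R}\Rightarrow w:p,w:\overline{p},\Gamma$ (no premises); $(\vee_r)$: $\mathcal{R}\Rightarrow w:\phi,w:\psi,\Gamma$ / $\mathcal{R}\Rightarrow w:\phi\vee\psi,\Gamma$; $(\wedge_r)$: $\mathcal{R}\Rightarrow w:\phi,\Gamma$ and $\mathcal{R}\Rightarrow w:\psi,\Gamma$ / $\mathcal{R}\Rightarrow w:\phi\wedge\psi,\Gamma$; $([\chi])$: $\mathcal{R},R_\chi wu\Rightarrow u:\phi,\Gamma$ / $\mathcal{R}\Rightarrow w:[\chi]\phi,\Gamma$ with $u$ fresh; $(Pr_{\langle\chi\rangle})$: $\mathcal{R}\Rightarrow w:\langle\chi\rangle\phi,u:\phi,\Gamma$ / $\mathcal{R}\Rightarrow w:\langle\chi\rangle\phi,\Gamma$, provided there is a propagation path from $w$ to $u$ whose string is in $L_S(\chi)$. -}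

module Defs where

open import Data.Nat using (ℕ)
open import Data.Fin using (Fin)
open import Data.List using (List; []; _∷_; _++_; [_]; map; reverse; concatMap)
open import Data.List.Membership.Propositional using (_∈_; _∉_)
open import Data.List.Relation.Binary.Permutation.Propositional using (_↭_)
open import Data.Product using (_×_; _,_; Σ)
open import Data.Unit using (⊤)
open import Relation.Binary.PropositionalEquality using (_≡_)
open import Relation.Binary.Construct.Closure.ReflexiveTransitive using (Star)

record Alphabet : Set where
  field
    size  : ℕ
    conv  : Fin size → Fin size
    invol : ∀ χ → conv (conv χ) ≡ χ

module _ (A : Alphabet) where
  open Alphabet A

  Char : Set
  Char = Fin size

  convStr : List Char → List Char
  convStr s = reverse (map conv s)

  record CFCST : Set₁ where
    field
      Rule   : Char → List Char → Set
      closed : ∀ {χ s} → Rule χ s → Rule (conv χ) (convStr s)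

  data Step (S : CFCST) : List Char → List Char → Set where
    step : ∀ a b χ' s' → CFCST.Rule S χ' s' →
           Step S (a ++ χ' ∷ b) (a ++ s' ++ b)

  L : CFCST → Char → List Char → Set
  L S χ s = Star (Step S) [ χ ] s

  Label : Set
  Label = ℕ

  data Formula : Set where
    pos  : ℕ → Formula
    neg  : ℕ → Formula
    _∨ᶠ_ : Formula → Formula → Formula
    _∧ᶠ_ : Formula → Formula → Formula
    dia⟨_⟩_ : Char → Formula → Formula
    box⟦_⟧_ : Char → Formula → Formula

  record RelAtom : Set where
    constructor rel
    field
      χ   : Char
      src : Label
      tgt : Label

  record LFormula : Set where
    constructor _∶_
    field
      lab : Label
      fml : Formula

  -- labelled sequent R ⇒ Γ (multisets represented as lists; rules
  -- match the conclusion up to permutation)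
  record Sequent : Set where
    constructor _⇒_
    field
      rels : List RelAtom
      fmls : List LFormula

  -- labels occurring in a sequent (= vertices of its sequent graph)
  labels : Sequent → List Label
  labels (R ⇒ Γ) = concatMap (λ { (rel _ w u) → w ∷ u ∷ [] }) R
                   ++ map LFormula.lab Γ

  -- Sequent graph: directed paths (edge w → u for each R_χ w u ∈ R;
  -- parallel edges from repeated atoms are distinct edges)

  data Path (R : List RelAtom) : Label → Label → Set where
    nil  : ∀ {x} → Path R x x
    cons : ∀ {χ x z y} → rel χ x z ∈ R → Path R z y → Path R x y

  IsTreeWithRoot : Label → Sequent → Set
  IsTreeWithRoot w (R ⇒ Γ) =
    (w ∈ labels (R ⇒ Γ)) ×
    (∀ v → v ∈ labels (R ⇒ Γ) → Path R w v) ×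
    (∀ v → (p q : Path R w v) → p ≡ q)

  data PropPath (R : List RelAtom) : Label → Label → List Char → Set where
    nil : ∀ {x} → PropPath R x x []
    fwd : ∀ {χ x z y s} → rel χ x z ∈ R → PropPath R z y s →
          PropPath R x y (χ ∷ s)
    bwd : ∀ {χ x z y s} → rel χ z x ∈ R → PropPath R z y s →
          PropPath R x y (conv χ ∷ s)

  data Deriv (S : CFCST) : Sequent → Set where
    id   : ∀ {R Γ Γ' w p} →
           Γ ↭ ((w ∶ pos p) ∷ (w ∶ neg p) ∷ Γ') →
           Deriv S (R ⇒ Γ)
    orR  : ∀ {R Γ Γ' w φ ψ} →
           Γ ↭ ((w ∶ (φ ∨ᶠ ψ)) ∷ Γ') →
           Deriv S (R ⇒ ((w ∶ φ) ∷ (w ∶ ψ) ∷ Γ')) →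
           Deriv S (R ⇒ Γ)
    andR : ∀ {R Γ Γ' w φ ψ} →
           Γ ↭ ((w ∶ (φ ∧ᶠ ψ)) ∷ Γ') →
           Deriv S (R ⇒ ((w ∶ φ) ∷ Γ')) →
           Deriv S (R ⇒ ((w ∶ ψ) ∷ Γ')) →
           Deriv S (R ⇒ Γ)
    box  : ∀ {R Γ Γ' w u χ φ} →
           Γ ↭ ((w ∶ (box⟦ χ ⟧ φ)) ∷ Γ') →
           u ∉ labels (R ⇒ Γ) →
           Deriv S ((rel χ w u ∷ R) ⇒ ((u ∶ φ) ∷ Γ')) →
           Deriv S (R ⇒ Γ)
    prop : ∀ {R Γ Γ' w u χ φ s} →
           Γ ↭ ((w ∶ (dia⟨ χ ⟩ φ)) ∷ Γ') →
           PropPath R w u s → L S χ s →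
           Deriv S (R ⇒ ((w ∶ (dia⟨ χ ⟩ φ)) ∷ (u ∶ φ) ∷ Γ')) →
           Deriv S (R ⇒ Γ)

  Every : ∀ {S Sq} → (Sequent → Set) → Deriv S Sq → Set
  Every {Sq = Sq} P (id _)          = P Sq
  Every {Sq = Sq} P (orR _ d)       = P Sq × Every P d
  Every {Sq = Sq} P (andR _ d₁ d₂)  = P Sq × Every P d₁ × Every P d₂
  Every {Sq = Sq} P (box _ _ d)     = P Sq × Every P d
  Every {Sq = Sq} P (prop _ _ _ d)  = P Sq × Every P d

-- Only the rule ([χ])
-- changes the relational atoms, and it adds one edge from a reachable label to
-- a fresh one; the fresh label has no outgoing edges, so every path into it is
-- a path into its parent followed by the new edge, and uniqueness is preserved.
module Submission where

open import Defs
open import Data.List using (List; []; _∷_; [_])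
open import Data.List.Relation.Unary.Any using (here; there)
open import Data.List.Relation.Unary.All as All using (All; []; _∷_)
open import Data.List.Membership.Propositional using (_∈_; _∉_)
open import Data.List.Membership.Propositional.Properties using (∈-map⁺; ∈-map⁻)
open import Data.List.Relation.Binary.Permutation.Propositional using (_↭_; ↭-sym)
open import Data.List.Relation.Binary.Permutation.Propositional.Properties using (All-resp-↭; ∈-resp-↭)
open import Data.Product using (_×_; _,_; Σ; proj₁; proj₂)
open import Data.Empty using (⊥-elim)
open import Data.Nat using (_≟_)
open import Relation.Nullary using (yes; no)
open import Relation.Binary.PropositionalEquality using (_≡_; _≢_; refl; sym; cong)

module _ {A : Alphabet} where

  UniquePaths : List (RelAtom A) → Label A → Set
  UniquePaths R w = ∀ v (p q : Path A R w v) → p ≡ q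

  src∈labels : ∀ {R Γ χ x z} → rel χ x z ∈ R → x ∈ labels A (R ⇒ Γ)
  src∈labels         (here refl) = here refl
  src∈labels {_ ∷ R} (there m)   = there (there (src∈labels {R} m))

  tgt∈labels : ∀ {R Γ χ x z} → rel χ x z ∈ R → z ∈ labels A (R ⇒ Γ)
  tgt∈labels         (here refl) = there (here refl)
  tgt∈labels {_ ∷ R} (there m)   = there (there (tgt∈labels {R} m))

  lab∈labels : ∀ {R Γ f} → f ∈ Γ → LFormula.lab f ∈ labels A (R ⇒ Γ)
  lab∈labels {[]}    m = ∈-map⁺ LFormula.lab m
  lab∈labels {_ ∷ R} m = there (there (lab∈labels {R} m))

  NoOutEdges : List (RelAtom A) → Label A → Set
  NoOutEdges R u = ∀ {χ z} → rel χ u z ∉ R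

  path-from-sink : ∀ {R u y} → NoOutEdges R u → Path A R u y → u ≡ y
  path-from-sink sink nil        = refl
  path-from-sink sink (cons m _) = ⊥-elim (sink m)

  loop-at-sink : ∀ {R u} → NoOutEdges R u → (p : Path A R u u) → p ≡ nil
  loop-at-sink sink nil        = refl
  loop-at-sink sink (cons m _) = ⊥-elim (sink m)

  module Graft {R : List (RelAtom A)} {χ : Char A} {w' u : Label A}
               (u-fresh : ∀ {χ' x z} → rel χ' x z ∈ R → x ≢ u × z ≢ u)
               (w'≢u : w' ≢ u) where

    R⁺ : List (RelAtom A)
    R⁺ = rel χ w' u ∷ R

    weaken : ∀ {x y} → Path A R x y → Path A R⁺ x y
    weaken nil        = nil
    weaken (cons m p) = cons (there m) (weaken p)

    extend : ∀ {x} → Path A R x w' → Path A R⁺ x u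
    extend nil        = cons (here refl) nil
    extend (cons m p) = cons (there m) (extend p)

    u-sink : NoOutEdges R⁺ u
    u-sink (here eq) = w'≢u (sym (cong RelAtom.src eq))
    u-sink (there m) = proj₁ (u-fresh m) refl

    weaken-onto : ∀ {x y} → y ≢ u → (p : Path A R⁺ x y) → Σ (Path A R x y) λ p₀ → weaken p₀ ≡ p
    weaken-onto y≢u nil                  = nil , refl
    weaken-onto y≢u (cons (here refl) p) = ⊥-elim (y≢u (sym (path-from-sink u-sink p)))
    weaken-onto y≢u (cons (there m) p) with weaken-onto y≢u p
    ... | p₀ , refl = cons m p₀ , refl

    extend-onto : ∀ {x} → x ≢ u → (p : Path A R⁺ x u) → Σ (Path A R x w') λ p₀ → extend p₀ ≡ p
    extend-onto x≢u nil                  = ⊥-elim (x≢u refl)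
    extend-onto _   (cons (here refl) p) = nil , cong (cons (here refl)) (sym (loop-at-sink u-sink p))
    extend-onto _   (cons (there m) p) with extend-onto (proj₂ (u-fresh m)) p
    ... | p₀ , refl = cons m p₀ , refl

    graft-unique : ∀ {w} → w ≢ u → UniquePaths R w → UniquePaths R⁺ w
    graft-unique w≢u unique v p q with v ≟ u
    ... | yes refl with extend-onto w≢u p | extend-onto w≢u q
    ...   | p₀ , refl | q₀ , refl = cong extend (unique w' p₀ q₀)
    graft-unique w≢u unique v p q | no v≢u with weaken-onto v≢u p | weaken-onto v≢u q
    ...   | p₀ , refl | q₀ , refl = cong weaken (unique v p₀ q₀)

  AtomReachable : List (RelAtom A) → Label A → RelAtom A → Set
  AtomReachable R w a = Path A R w (RelAtom.src a) × Path A R w (RelAtom.tgt a)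

  record RootedAt (w : Label A) (R : List (RelAtom A)) (Γ : List (LFormula A)) : Set where
    constructor rooted
    field
      atoms-reachable    : All (AtomReachable R w) R
      formulas-reachable : All (λ f → Path A R w (LFormula.lab f)) Γ
      paths-unique       : UniquePaths R w

  rooted-resp-↭ : ∀ {w R Γ Γ'} → Γ ↭ Γ' → RootedAt w R Γ → RootedAt w R Γ'
  rooted-resp-↭ π (rooted ar fr un) = rooted ar (All-resp-↭ π fr) un

  labels-reachable : ∀ {R₀ w} R Γ → All (AtomReachable R₀ w) R →
                     All (λ f → Path A R₀ w (LFormula.lab f)) Γ →
                     ∀ v → v ∈ labels A (R ⇒ Γ) → Path A R₀ w v
  labels-reachable []      Γ _              fr v m with ∈-map⁻ LFormula.lab m
  ... | f , f∈Γ , refl = All.lookup fr f∈Γ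
  labels-reachable (_ ∷ R) Γ ((s , _) ∷ _)  fr v (here refl)         = s
  labels-reachable (_ ∷ R) Γ ((_ , t) ∷ _)  fr v (there (here refl)) = t
  labels-reachable (_ ∷ R) Γ (_ ∷ ar)       fr v (there (there m))   = labels-reachable R Γ ar fr v m

  root∈labels : ∀ {R Γ w v} → Path A R w v → v ∈ labels A (R ⇒ Γ) → w ∈ labels A (R ⇒ Γ)
  root∈labels     nil        v∈ = v∈
  root∈labels {R} (cons e _) _  = src∈labels {R} e

  rooted-tree : ∀ {w R Γ Γ' f} → RootedAt w R Γ → Γ ↭ (f ∷ Γ') → IsTreeWithRoot A w (R ⇒ Γ)
  rooted-tree {R = R} {Γ} {f = f} (rooted ar fr un) π =
    root∈labels {R} (All.lookup fr f∈Γ) (lab∈labels {R} f∈Γ) , labels-reachable R Γ ar fr , un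
    where
    f∈Γ : f ∈ Γ
    f∈Γ = ∈-resp-↭ (↭-sym π) (here refl)

  reachable-along : ∀ {R w x y s} → All (AtomReachable R w) R →
                    Path A R w x → PropPath A R x y s → Path A R w y
  reachable-along ar r nil        = r
  reachable-along ar r (fwd m pp) = reachable-along ar (proj₂ (All.lookup ar m)) pp
  reachable-along ar r (bwd m pp) = reachable-along ar (proj₁ (All.lookup ar m)) pp

  rooted-graft : ∀ {w R Γ Γ' w' u χ ψ φ} → RootedAt w R Γ → Γ ↭ ((w' ∶ ψ) ∷ Γ') →
                 u ∉ labels A (R ⇒ Γ) → RootedAt w (rel χ w' u ∷ R) ((u ∶ φ) ∷ Γ')
  rooted-graft {R = R} {Γ} {u = u} {χ} ρ π u∉ with rooted-resp-↭ π ρ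
  ... | rooted ar (r ∷ fr) un =
        rooted ((weaken r , extend r) ∷ All.map (λ (s , t) → weaken s , weaken t) ar)
               (extend r ∷ All.map weaken fr)
               (graft-unique (≢u (proj₁ (rooted-tree ρ π))) un)
    where
    ≢u : ∀ {v} → v ∈ labels A (R ⇒ Γ) → v ≢ u
    ≢u v∈ refl = u∉ v∈
    open Graft {χ = χ} (λ m → ≢u (src∈labels {R} m) , ≢u (tgt∈labels {R} m))
                       (≢u (lab∈labels {R} (∈-resp-↭ (↭-sym π) (here refl))))

  module _ (S : CFCST A) {w : Label A} where

    every-rooted : ∀ {R Γ} (d : Deriv A S (R ⇒ Γ)) → RootedAt w R Γ → Every A (IsTreeWithRoot A w) d
    every-rooted (id π) ρ = rooted-tree ρ π
    every-rooted (orR π d) ρ with rooted-resp-↭ π ρ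
    ... | rooted ar (r ∷ fr) un = rooted-tree ρ π , every-rooted d (rooted ar (r ∷ r ∷ fr) un)
    every-rooted (andR π d₁ d₂) ρ with rooted-resp-↭ π ρ
    ... | rooted ar (r ∷ fr) un =
          rooted-tree ρ π , every-rooted d₁ (rooted ar (r ∷ fr) un) , every-rooted d₂ (rooted ar (r ∷ fr) un)
    every-rooted (box π u∉ d) ρ = rooted-tree ρ π , every-rooted d (rooted-graft ρ π u∉)
    every-rooted (prop π pp _ d) ρ with rooted-resp-↭ π ρ
    ... | rooted ar (r ∷ fr) un =
          rooted-tree ρ π , every-rooted d (rooted ar (r ∷ reachable-along ar r pp ∷ fr) un)

  rooted-initial : ∀ {w φ} → RootedAt w [] [ w ∶ φ ]
  rooted-initial = rooted [] (nil ∷ []) λ { _ nil nil → refl }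

mainTheorem2 : (A : Alphabet) (S : CFCST A) (w : Label A) (φ : Formula A)
    (d : Deriv A S (_⇒_ [] [ _∶_ w φ ])) →
    Every A (IsTreeWithRoot A w) d
mainTheorem2 A S w φ d = every-rooted S d rooted-initial
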